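{- Let $q>1$ be an integer and, for each $n\ge1$, let $B_n$ be a cyclic $q$-ary de Bruijn sequence of order $n$ (over the alphabet $\{0,1,\ldots,q-1\}$) starting with $n$ zeros. Let $\mathbf{x}=0^{q^{q^1}}B_1\,0^{q^{q^2}}B_2\,0^{q^{q^3}}B_3\cdots.$ Then $\mathbf{x}$ has factor complexity $c_{\mathbf{x}}(n)=q^n$ and satisfies $\operatorname{nsc}_{\mathbf{x}}(n)\le 4n$ for all $n\ge1$.
   Context: A cyclic $q$-ary de Bruijn sequence of order $n$ is a word of length $q^n$ that contains every $q$-ary word of length $n$ exactly as a circular factor, i.e. as a factor of some cyclic shift of it. The factor complexity $c_{\mathbf{x}}(n)$ is the number of distinct length-$n$ factors of $\mathbf{x}$. For an infinite word $\mathbf{x}=x_0x_1x_2\cdots$ (indexed from $0$) and $n\ge1$, $\operatorname{nsc}_{\mathbf{x}}(n)=\max\{m\in\mathbb{N}: x_i\cdots x_{i+n-1}\neq x_j\cdots x_{j+n-1}\text{ for all } 0\le i<j\le m-1\}$. -}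

module Defs where

open import Data.Nat using (ℕ; zero; suc; _+_; _*_; _^_; _<_; _≤_; s≤s; z≤n; NonZero)
open import Data.Nat.DivMod using (_%_; m%n<n)
open import Data.Nat.Properties using (m^n≢0)
open import Data.Fin using (Fin; toℕ; fromℕ<)
open import Data.Vec using (Vec; lookup; tabulate)
open import Data.List using (List; length)
open import Data.List.Relation.Unary.All using (All)
open import Data.List.Relation.Unary.Unique.Propositional using (Unique)
open import Data.List.Membership.Propositional using (_∈_)
open import Data.Product using (Σ; _×_; ∃)
open import Relation.Binary.PropositionalEquality using (_≡_; _≢_)

𝟎 : ∀ {q} → 1 < q → Fin q
𝟎 {suc q} _ = Data.Fin.zero

Word : ℕ → Set
Word q = ℕ → Fin q

factorAt : ∀ {q} → Word q → ℕ → (n : ℕ) → Vec (Fin q) n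
factorAt x i n = tabulate (λ k → x (i + toℕ k))

IsFactor : ∀ {q n} → Word q → Vec (Fin q) n → Set
IsFactor {n = n} x w = ∃ λ i → factorAt x i n ≡ w

FactorComplexityIs : ∀ {q} → Word q → ℕ → ℕ → Set
FactorComplexityIs {q} x n k =
  Σ (List (Vec (Fin q) n)) λ L →
    length L ≡ k × Unique L × All (IsFactor x) L ×
    (∀ (w : Vec (Fin q) n) → IsFactor x w → w ∈ L)

FirstFactorsDistinct : ∀ {q} → Word q → ℕ → ℕ → Set
FirstFactorsDistinct x n m =
  ∀ i j → i < j → j < m → factorAt x i n ≢ factorAt x j n

NscIs : ∀ {q} → Word q → ℕ → ℕ → Set
NscIs x n m = FirstFactorsDistinct x n m × (∀ m' → FirstFactorsDistinct x n m' → m' ≤ m)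

circFactorAt : ∀ {q N} .{{_ : NonZero N}} → Vec (Fin q) N → ℕ → (n : ℕ) → Vec (Fin q) n
circFactorAt {N = N} B i n =
  tabulate (λ k → lookup B (fromℕ< (m%n<n (i + toℕ k) N)))

pow-nonZero : ∀ {q} → 1 < q → ∀ n → NonZero (q ^ n)
pow-nonZero {suc q} _ n = m^n≢0 (suc q) n

IsDeBruijn : ∀ q → 1 < q → ∀ n → Vec (Fin q) (q ^ n) → Set
IsDeBruijn q q>1 n B =
  ∀ (w : Vec (Fin q) n) → ∃ λ i → i < q ^ n × circFactorAt {{pow-nonZero q>1 n}} B i n ≡ w

-- Starting position of the k-th block 0^{q^{q^{k+1}}} B_{k+1} in x.
blockStart : ℕ → ℕ → ℕ
blockStart q zero = 0
blockStart q (suc k) = blockStart q k + q ^ (q ^ suc k) + q ^ suc k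

module Submission where

-- The word x consists of blocks 0^{R_k} B_{k+1}, where R_k = q^{q^{k+1}} and
-- the block starts at position blockStart q k.  The two claims are proved
-- separately.
--
-- Every q-ary word of length n is a factor of x: it is a
-- circular factor of the de Bruijn word B_n, and since B_n begins with n zeros
-- and is followed in x by a long run of zeros, the wrap-around part of a
-- circular factor is read off that run.
--
-- As soon as some length-n factor at position j
-- repeats an earlier one, nsc_x(n) exists and is at most j (general lemma
-- 'nsc-bounded-by-repeat').  A run of n+1 equal letters starting at s gives
-- such a repetition at j = s+1; taking the first zero run of length > n, the
-- growth of R_k forces its start to lie below 4n.

open import Defs
open import Data.Nat using (ℕ; zero; suc; _+_; _*_; _^_; _<_; _≤_; z≤n; s≤s; NonZero; >-nonZero)
open import Data.Nat.Properties
open import Data.Nat.DivMod using (_%_; m%n<n; [m+n]%n≡m%n; m<n⇒m%n≡m)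
open import Data.Nat.Induction using (<-rec)
open import Data.Nat.Tactic.RingSolver using (solve-∀)
open import Data.Fin using (Fin; toℕ; fromℕ<)
import Data.Fin as Fin
open import Data.Fin.Properties using (toℕ<n; toℕ-fromℕ<)
open import Data.Vec using (Vec; lookup)
open import Data.Vec.Properties using (tabulate-cong; ∷-injective; ≡-dec)
open import Data.List using (List; length; map; _++_; cartesianProductWith; allFin)
open import Data.List.Properties using (length-map; length-++; length-tabulate)
import Data.List.Relation.Unary.All as All
import Data.List.Relation.Unary.Any as Any
import Data.List.Relation.Unary.Any.Properties as Any
open import Data.List.Relation.Unary.Unique.Propositional using (Unique)
import Data.List.Relation.Unary.Unique.Propositional.Properties as Unique
import Data.List.Relation.Unary.AllPairs as AllPairs
open import Data.List.Membership.Propositional using (_∈_)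
open import Data.List.Membership.Propositional.Properties using (∈-allFin)
open import Data.Product using (Σ; _×_; _,_; ∃)
open import Data.Empty using (⊥-elim)
open import Relation.Nullary using (Dec; yes; no)
open import Relation.Binary.PropositionalEquality using (_≡_; refl; sym; trans; cong; cong₂; subst; module ≡-Reasoning)

allWords : ∀ q n → List (Vec (Fin q) n)
allWords q zero    = Vec.[] List.∷ List.[]
allWords q (suc n) = cartesianProductWith Vec._∷_ (allFin q) (allWords q n)

length-cartesianProductWith : ∀ {A B C : Set} (f : A → B → C) xs ys →
  length (cartesianProductWith f xs ys) ≡ length xs * length ys
length-cartesianProductWith f List.[] ys = refl
length-cartesianProductWith f (a List.∷ xs) ys = begin
  length (map (f a) ys ++ cartesianProductWith f xs ys)          ≡⟨ length-++ (map (f a) ys) ⟩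
  length (map (f a) ys) + length (cartesianProductWith f xs ys)  ≡⟨ cong₂ _+_ (length-map (f a) ys)
                                                                      (length-cartesianProductWith f xs ys) ⟩
  length ys + length xs * length ys                              ∎
  where open ≡-Reasoning

length-allWords : ∀ q n → length (allWords q n) ≡ q ^ n
length-allWords q zero    = refl
length-allWords q (suc n) = begin
  length (allWords q (suc n))                ≡⟨ length-cartesianProductWith Vec._∷_ (allFin q) (allWords q n) ⟩
  length (allFin q) * length (allWords q n)  ≡⟨ cong₂ _*_ (length-tabulate {n = q} (λ i → i)) (length-allWords q n) ⟩
  q * q ^ n                                  ∎
  where open ≡-Reasoning

allWords-unique : ∀ q n → Unique (allWords q n)
allWords-unique q zero    = All.[] AllPairs.∷ AllPairs.[]
allWords-unique q (suc n) =
  Unique.cartesianProductWith⁺ Vec._∷_ ∷-injective (Unique.allFin⁺ q) (allWords-unique q n)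

∈-allWords : ∀ {q n} (w : Vec (Fin q) n) → w ∈ allWords q n
∈-allWords Vec.[]       = Any.here refl
∈-allWords (a Vec.∷ w) =
  Any.cartesianProductWith⁺ Vec._∷_ (λ { refl refl → refl }) (∈-allFin a) (∈-allWords w)

complexity-of-universal : ∀ {q} (x : Word q) n →
  (∀ (w : Vec (Fin q) n) → IsFactor x w) → FactorComplexityIs x n (q ^ n)
complexity-of-universal {q} x n universal =
  allWords q n , length-allWords q n , allWords-unique q n ,
  All.tabulate (λ {w} _ → universal w) , λ w _ → ∈-allWords w

RepeatsEarlier : ∀ {q} → Word q → ℕ → ℕ → Set
RepeatsEarlier x n j = ∃ λ i → i < j × factorAt x i n ≡ factorAt x j n

repeatsEarlier? : ∀ {q} (x : Word q) n j → Dec (RepeatsEarlier x n j)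
repeatsEarlier? x n j = anyUpTo? (λ i → ≡-dec Fin._≟_ (factorAt x i n) (factorAt x j n)) j

-- If some position j repeats an earlier length-n factor, then nsc_x(n) exists
-- and is at most j: it is the first position that repeats an earlier factor.
nsc-bounded-by-repeat : ∀ {q} (x : Word q) n j →
  RepeatsEarlier x n j → Σ ℕ λ m → NscIs x n m × m ≤ j
nsc-bounded-by-repeat x n = <-rec _ step
  where
    step : ∀ j → (∀ {j′} → j′ < j → RepeatsEarlier x n j′ → Σ ℕ λ m → NscIs x n m × m ≤ j′) →
           RepeatsEarlier x n j → Σ ℕ λ m → NscIs x n m × m ≤ j
    step j earlier (i , i<j , repeat) with anyUpTo? (repeatsEarlier? x n) j
    ... | yes (j′ , j′<j , repeat′) =
      let m , nsc , m≤j′ = earlier j′<j repeat′ in m , nsc , ≤-trans m≤j′ (<⇒≤ j′<j)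
    ... | no noEarlierRepeat = j , (distinct , maximal) , ≤-refl
      where
        distinct : FirstFactorsDistinct x n j
        distinct i′ j′ i′<j′ j′<j eq = noEarlierRepeat (j′ , j′<j , i′ , i′<j′ , eq)

        maximal : ∀ m′ → FirstFactorsDistinct x n m′ → m′ ≤ j
        maximal m′ distinct′ with m′ ≤? j
        ... | yes m′≤j = m′≤j
        ... | no  m′≰j = ⊥-elim (distinct′ i j i<j (≰⇒> m′≰j) repeat)

constant-run-repeats : ∀ {q} (x : Word q) (c : Fin q) s n →
  (∀ t → t ≤ n → x (s + t) ≡ c) → RepeatsEarlier x n (suc s)
constant-run-repeats x c s n run = s , ≤-refl , tabulate-cong shifted
  where
    shifted : ∀ (t : Fin n) → x (s + toℕ t) ≡ x (suc (s + toℕ t))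
    shifted t = begin
      x (s + toℕ t)        ≡⟨ run (toℕ t) (<⇒≤ (toℕ<n t)) ⟩
      c                    ≡⟨ sym (run (suc (toℕ t)) (toℕ<n t)) ⟩
      x (s + suc (toℕ t))  ≡⟨ cong x (+-suc s (toℕ t)) ⟩
      x (suc (s + toℕ t))  ∎
      where open ≡-Reasoning

-- Suppose a cyclic word B of length N ≥ n begins with n copies of the letter
-- c and is written at position s of x, followed by at least n further c's.
-- Then x agrees with the periodic extension of B on [s, s + N + n), so every
-- circular factor of B of length n starting before N is a factor of x.
module CyclicWordInside {q N} .{{_ : NonZero N}}
  (x : Word q) (B : Vec (Fin q) N) (c : Fin q) (s n : ℕ) (n≤N : n ≤ N)
  (written  : ∀ (j : Fin N) → x (s + toℕ j) ≡ lookup B j)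
  (prefix   : ∀ (j : Fin N) → toℕ j < n → lookup B j ≡ c)
  (followed : ∀ r → r < n → x (s + N + r) ≡ c)
  where

  periodic : ℕ → Fin q
  periodic p = lookup B (fromℕ< (m%n<n p N))

  toℕ-index : ∀ p → toℕ (fromℕ< (m%n<n p N)) ≡ p % N
  toℕ-index p = toℕ-fromℕ< (m%n<n p N)

  wrapped-index : ∀ r → r < N → toℕ (fromℕ< (m%n<n (N + r) N)) ≡ r
  wrapped-index r r<N = begin
    toℕ (fromℕ< (m%n<n (N + r) N))  ≡⟨ toℕ-index (N + r) ⟩
    (N + r) % N                     ≡⟨ cong (_% N) (+-comm N r) ⟩
    (r + N) % N                     ≡⟨ [m+n]%n≡m%n r N ⟩
    r % N                           ≡⟨ m<n⇒m%n≡m r<N ⟩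
    r                               ∎
    where open ≡-Reasoning

  agrees-periodic : ∀ p → p < N + n → x (s + p) ≡ periodic p
  agrees-periodic p p<N+n with p <? N
  ... | yes p<N = begin
    x (s + p)                                    ≡⟨ cong (λ i → x (s + i)) p≡index ⟩
    x (s + toℕ (fromℕ< (m%n<n p N)))            ≡⟨ written _ ⟩
    periodic p                                   ∎
    where
      open ≡-Reasoning
      p≡index : p ≡ toℕ (fromℕ< (m%n<n p N))
      p≡index = sym (trans (toℕ-index p) (m<n⇒m%n≡m p<N))
  ... | no p≮N with m≤n⇒∃[o]m+o≡n (≮⇒≥ p≮N)
  ...   | r , refl = begin
    x (s + (N + r))  ≡⟨ cong x (sym (+-assoc s N r)) ⟩
    x (s + N + r)    ≡⟨ followed r r<n ⟩
    c                ≡⟨ sym (prefix _ index<n) ⟩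
    periodic (N + r) ∎
    where
      open ≡-Reasoning
      r<n : r < n
      r<n = +-cancelˡ-< N r n p<N+n
      index<n : toℕ (fromℕ< (m%n<n (N + r) N)) < n
      index<n = subst (_< n) (sym (wrapped-index r (<-≤-trans r<n n≤N))) r<n

  circular-factor-occurs : ∀ i → i < N → factorAt x (s + i) n ≡ circFactorAt B i n
  circular-factor-occurs i i<N = tabulate-cong λ t → trans
    (cong x (+-assoc s i (toℕ t)))
    (agrees-periodic (i + toℕ t) (+-mono-< i<N (toℕ<n t)))

module BlockArithmetic (q : ℕ) (q>1 : 1 < q) where

  -- Needed for the monotonicity lemmas of q^_.
  instance
    q-nonZero : NonZero q
    q-nonZero = >-nonZero (<-trans (s≤s z≤n) q>1)

  -- Length of the zero run opening block k.
  R : ℕ → ℕ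
  R k = q ^ (q ^ suc k)

  n<q^n : ∀ n → n < q ^ n
  n<q^n zero    = s≤s z≤n
  n<q^n (suc n) = begin-strict
    suc n      ≤⟨ n<q^n n ⟩
    q ^ n      <⟨ m<m*n (q ^ n) q {{m^n≢0 q n}} q>1 ⟩
    q ^ n * q  ≡⟨ *-comm (q ^ n) q ⟩
    q ^ suc n  ∎
    where open ≤-Reasoning

  R-dominates : ∀ {m} k → m ≤ q ^ suc k → q ^ m ≤ R k
  R-dominates k = ^-monoʳ-≤ q

  3≤R : ∀ k → 3 ≤ R k
  3≤R k = begin-strict
    2          ≤⟨ q>1 ⟩
    q          ≡⟨ sym (*-identityʳ q) ⟩
    q ^ 1      ≤⟨ ^-monoʳ-≤ q {1} {suc k} (s≤s z≤n) ⟩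
    q ^ suc k  <⟨ n<q^n (q ^ suc k) ⟩
    R k        ∎
    where open ≤-Reasoning

  R-growth : ∀ k → 3 * R k ≤ R (suc k)
  R-growth k = begin
    3 * R k          ≤⟨ *-monoˡ-≤ (R k) (3≤R k) ⟩
    R k * R k        ≡⟨ sym (^-distribˡ-+-* q X X) ⟩
    q ^ (X + X)      ≤⟨ ^-monoʳ-≤ q X+X≤q*X ⟩
    q ^ (q * X)      ∎
    where
      open ≤-Reasoning
      X : ℕ
      X = q ^ suc k
      X+X≤q*X : X + X ≤ q * X
      X+X≤q*X = subst (_≤ q * X) (cong (X +_) (+-identityʳ X)) (*-monoˡ-≤ X q>1)

  -- Block k+1 starts at most at twice the length of the zero run of block k:
  -- induction using q^{k+2} ≤ R_k and 3 R_k ≤ R_{k+1}.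
  blockStart-bound : ∀ k → blockStart q (suc k) ≤ 2 * R k
  blockStart-bound zero = begin
    R 0 + q ^ 1  ≤⟨ +-monoʳ-≤ (R 0) (R-dominates 0 (<⇒≤ (n<q^n 1))) ⟩
    R 0 + R 0    ≡⟨ cong (R 0 +_) (sym (+-identityʳ (R 0))) ⟩
    2 * R 0      ∎
    where open ≤-Reasoning
  blockStart-bound (suc k) = begin
    blockStart q (suc k) + R (suc k) + q ^ suc (suc k)
      ≤⟨ +-mono-≤ (+-monoˡ-≤ (R (suc k)) (blockStart-bound k)) (R-dominates k (n<q^n (suc k))) ⟩
    2 * R k + R (suc k) + R k
      ≡⟨ regroup (R k) (R (suc k)) ⟩
    3 * R k + R (suc k)
      ≤⟨ +-monoˡ-≤ (R (suc k)) (R-growth k) ⟩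
    R (suc k) + R (suc k)
      ≡⟨ cong (R (suc k) +_) (sym (+-identityʳ (R (suc k)))) ⟩
    2 * R (suc k)
      ∎
    where
      open ≤-Reasoning
      regroup : ∀ a b → 2 * a + b + a ≡ 3 * a + b
      regroup = solve-∀

  -- Searching downwards from a block k whose zero run is longer than n, the
  -- first such block starts at a position s with s + 1 ≤ 4n: either it is
  -- block 0, or the previous run has length R_{k-1} ≤ n and the start is at
  -- most 2 R_{k-1}.
  first-long-run-below : ∀ n → 1 ≤ n → ∀ k → n < R k →
    Σ ℕ λ k′ → n < R k′ × suc (blockStart q k′) ≤ 4 * n
  first-long-run-below n 1≤n zero n<R = zero , n<R , ≤-trans 1≤n (m≤m+n n _)
  first-long-run-below n 1≤n (suc k) n<R with n <? R k
  ... | yes n<Rk = first-long-run-below n 1≤n k n<Rk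
  ... | no  n≮Rk = suc k , n<R , (begin
    suc (blockStart q (suc k))  ≤⟨ s≤s (blockStart-bound k) ⟩
    suc (2 * R k)               ≤⟨ +-monoˡ-≤ (2 * R k) (≤-trans (s≤s z≤n) (3≤R k)) ⟩
    3 * R k                     ≤⟨ *-monoˡ-≤ (R k) (n≤1+n 3) ⟩
    4 * R k                     ≤⟨ *-monoʳ-≤ 4 (≮⇒≥ n≮Rk) ⟩
    4 * n                       ∎)
    where open ≤-Reasoning

  -- The run of block n is longer than n, so the search has a starting point.
  n<R : ∀ n → n < R n
  n<R n = begin-strict
    n          <⟨ n<q^n n ⟩
    q ^ n      ≤⟨ R-dominates n (<⇒≤ (<-trans (n<1+n n) (n<q^n (suc n)))) ⟩
    R n        ∎
    where open ≤-Reasoning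

  first-long-run : ∀ n → 1 ≤ n → Σ ℕ λ k → n < R k × suc (blockStart q k) ≤ 4 * n
  first-long-run n 1≤n = first-long-run-below n 1≤n n (n<R n)

mainTheorem5 : (q : ℕ) (q>1 : 1 < q)
    (B : (n : ℕ) → Vec (Fin q) (q ^ n))
    → (∀ n → 1 ≤ n → IsDeBruijn q q>1 n (B n))
    → (∀ n → 1 ≤ n → (k : Fin (q ^ n)) → toℕ k < n → lookup (B n) k ≡ 𝟎 q>1)
    → (x : Word q)
    → (∀ k j → j < q ^ (q ^ suc k) → x (blockStart q k + j) ≡ 𝟎 q>1)
    → (∀ k (j : Fin (q ^ suc k)) →
         x (blockStart q k + q ^ (q ^ suc k) + toℕ j) ≡ lookup (B (suc k)) j)
    → ∀ n → 1 ≤ n →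
        FactorComplexityIs x n (q ^ n)
        × Σ ℕ (λ m → NscIs x n m × m ≤ 4 * n)
mainTheorem5 q q>1 B deBruijn zeroPrefix x zeroRun block n@(suc k) _ =
  complexity-of-universal x n everyWordOccurs , nscBound
  where
    open BlockArithmetic q q>1

    -- B_n sits in block k and is followed by the zero run of block k+1.
    everyWordOccurs : ∀ (w : Vec (Fin q) n) → IsFactor x w
    everyWordOccurs w with deBruijn n (s≤s z≤n) w
    ... | i , i<N , circular≡w = s + i , trans (circular-factor-occurs i i<N) circular≡w
      where
        s : ℕ
        s = blockStart q k + R k
        instance
          N-nonZero : NonZero (q ^ n)
          N-nonZero = pow-nonZero q>1 n
        open CyclicWordInside x (B n) (𝟎 q>1) s n (<⇒≤ (n<q^n n))
               (block k) (zeroPrefix n (s≤s z≤n))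
               (λ r r<n → zeroRun n r (<-trans r<n (n<R n)))

    -- The zero run of the first block whose run is longer than n.
    nscBound : Σ ℕ λ m → NscIs x n m × m ≤ 4 * n
    nscBound with first-long-run n (s≤s z≤n)
    ... | k′ , n<Rk′ , start<4n with nsc-bounded-by-repeat x n (suc (blockStart q k′))
          (constant-run-repeats x (𝟎 q>1) (blockStart q k′) n
            (λ t t≤n → zeroRun k′ t (≤-<-trans t≤n n<Rk′)))
    ...   | m , nsc , m≤start = m , nsc , ≤-trans m≤start start<4n
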